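{- Let $r \geq 2$ and let $k$ be an integer with $0 \leq k \leq r-2$. Then there exists a simple binary matroid of rank $r$ with a $k$-loose element whose ground set has size $2^k(r-k+1)$.
   Context: For a matroid $M$ of rank $r$ and a non-negative integer $k$, an element of $M$ is called $k$-loose if every circuit of $M$ that contains it has size greater than $r-k$. A binary matroid is one representable over $GF(2)$; a matroid is simple if it has no loops and no parallel pairs. -}

module Defs where

open import Data.Nat using (ℕ; zero; suc; _+_; _*_; _∸_; _^_; _≤_; _<_)
open import Data.Bool using (Bool; true; false; if_then_else_; _xor_)
open import Data.Vec using (Vec; []; _∷_; replicate; zipWith)
open import Data.Fin using (Fin)
import Data.Fin as F
open import Data.Fin.Subset using (Subset; _⊆_; _∈_; ∣_∣; Nonempty)
open import Data.Product using (Σ; ∃; _×_; _,_)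
open import Relation.Nullary using (¬_)
open import Relation.Binary.PropositionalEquality using (_≡_; _≢_)

-- A binary matroid is presented (up to isomorphism) as the vector matroid
-- of a binary matrix: ground set Fin n, element i ↦ column  cols i ∈ GF(2)^m.
-- GF(2) = Bool with addition xor.
Cols : ℕ → ℕ → Set
Cols n m = Fin n → Vec Bool m

zeroV : ∀ {m} → Vec Bool m
zeroV {m} = replicate m false

_⊕_ : ∀ {m} → Vec Bool m → Vec Bool m → Vec Bool m
_⊕_ = zipWith _xor_

sumCols : ∀ {n m} → Cols n m → Subset n → Vec Bool m
sumCols {zero}  A []      = zeroV
sumCols {suc n} A (b ∷ S) =
  (if b then A F.zero else zeroV) ⊕ sumCols (λ i → A (F.suc i)) S

Dependent : ∀ {n m} → Cols n m → Subset n → Set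
Dependent A S = ∃ λ T → T ⊆ S × Nonempty T × sumCols A T ≡ zeroV

Independent : ∀ {n m} → Cols n m → Subset n → Set
Independent A S = ¬ Dependent A S

Circuit : ∀ {n m} → Cols n m → Subset n → Set
Circuit A C = Dependent A C × (∀ T → T ⊆ C → T ≢ C → Independent A T)

HasRank : ∀ {n m} → Cols n m → ℕ → Set
HasRank A r = (∃ λ S → Independent A S × ∣ S ∣ ≡ r)
            × (∀ S → Independent A S → ∣ S ∣ ≤ r)

HasLoop : ∀ {n m} → Cols n m → Set
HasLoop A = ∃ λ C → Circuit A C × ∣ C ∣ ≡ 1

HasParallelPair : ∀ {n m} → Cols n m → Set
HasParallelPair A = ∃ λ C → Circuit A C × ∣ C ∣ ≡ 2

Simple : ∀ {n m} → Cols n m → Set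
Simple A = ¬ HasLoop A × ¬ HasParallelPair A

Loose : ∀ {n m} → Cols n m → (r k : ℕ) → Fin n → Set
Loose A r k e = ∀ C → Circuit A C → e ∈ C → r ∸ k < ∣ C ∣

{-# OPTIONS --safe #-}

-- With s = r − k ≥ 2, work in GF(2)^(s+k) and call the first s coordinates the prefix. The columns
-- are the heavy vector 1…1 0…0 with s ones, together with all light vectors: the nonzero vectors with
-- at most one 1 in the prefix. These are 1 + (2^k − 1) + s·2^k = 2^k(s + 1) distinct nonzero vectors,
-- so the matroid is simple; they contain the unit vectors, so it has rank s + k = r. The heavy element
-- is k-loose: in a circuit through it, it is the sum of the other elements, each of prefix weight at
-- most 1, so there are at least s of them and the circuit has more than s = r − k elements.
module Submission where

open import Defs
open import Data.Nat using (ℕ; zero; suc; _+_; _*_; _∸_; _^_; _≤_; _<_; z≤n; s≤s)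
open import Data.Nat.Properties
  using (≤-trans; ≤-reflexive; ≤-pred; <⇒≤; <⇒≱; ≮⇒≥; n≤1+n; m≤n⇒m≤1+n; +-monoʳ-≤; +-mono-≤; +-suc;
         +-comm; +-identityʳ; *-suc; *-identityʳ; m+n∸n≡m; m∸n+n≡m; m∸[m∸n]≡n; ∸-monoʳ-≤; m∸n≤m;
         module ≤-Reasoning)
  renaming (suc-injective to ℕ-suc-injective)
open import Data.Bool using (Bool; true; false; if_then_else_; _xor_)
open import Data.Bool.Properties
  using (_≟_; ¬-not; xor-assoc; xor-comm; xor-identityˡ; xor-identityʳ; xor-same)
open import Data.Empty using (⊥-elim)
open import Data.Fin using (Fin; zero; suc)
import Data.Fin.Properties as Fin
open import Data.Fin.Subset using (Subset; _⊆_; _∈_; _∉_; ∣_∣; Nonempty; ⊥; ⊤; ⁅_⁆; _-_)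
open import Data.Fin.Subset.Properties
  using (_∈?_; Empty-unique; ∉⊥; ∣⊥∣≡0; ∣⊤∣≡n; ∣⁅x⁆∣≡1; drop-∷-⊆; p─q⊆p; p─⊥≡p)
open import Data.Product using (Σ; ∃; _×_; _,_; -,_; proj₁; proj₂)
open import Data.Sum using (_⊎_; inj₁; inj₂)
open import Data.Vec
  using (Vec; []; _∷_; here; there; head; tail; replicate; map; _++_; lookup; take; splitAt; _[_]≔_)
open import Data.Vec.Properties
  using (zipWith-assoc; zipWith-comm; zipWith-identityˡ; zipWith-identityʳ; take-zipWith; lookup-map;
         ∷-injective; ∷-injectiveʳ; ++-injectiveʳ; ≡-dec; []=⇒lookup; lookup⇒[]=; lookup∘update′; []≔-minimal)
open import Data.Vec.Relation.Unary.All as All using (All; []; _∷_)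
import Data.Vec.Relation.Unary.All.Properties as All
open import Data.Vec.Relation.Unary.AllPairs using ([]; _∷_)
import Data.Vec.Relation.Unary.AllPairs.Properties as AllPairs
open import Data.Vec.Relation.Unary.Unique.Propositional using (Unique)
import Data.Vec.Relation.Unary.Unique.Propositional.Properties as Unique
open import Function using (_∘_; id)
open import Function.Definitions using (Injective)
open import Relation.Nullary using (yes; no; contradiction)
open import Relation.Nullary.Decidable using (_×-dec_)
open import Relation.Binary.PropositionalEquality
  using (_≡_; _≢_; refl; sym; trans; cong; cong₂; subst; subst₂; ≢-sym; module ≡-Reasoning)

private
  variable
    a b d m m′ n : ℕ

-- sumCols A (c ∷ T) unfolds to scale c (A zero) ⊕ sumCols (A ∘ suc) T.
scale : Bool → Vec Bool m → Vec Bool m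
scale c v = if c then v else zeroV

⊕-identityˡ : (v : Vec Bool m) → zeroV ⊕ v ≡ v
⊕-identityˡ = zipWith-identityˡ xor-identityˡ

⊕-identityʳ : (v : Vec Bool m) → v ⊕ zeroV ≡ v
⊕-identityʳ = zipWith-identityʳ xor-identityʳ

⊕-assoc : (u v w : Vec Bool m) → (u ⊕ v) ⊕ w ≡ u ⊕ (v ⊕ w)
⊕-assoc = zipWith-assoc xor-assoc

⊕-comm : (u v : Vec Bool m) → u ⊕ v ≡ v ⊕ u
⊕-comm = zipWith-comm xor-comm

⊕-same : (v : Vec Bool m) → v ⊕ v ≡ zeroV
⊕-same []      = refl
⊕-same (x ∷ v) = cong₂ _∷_ (xor-same x) (⊕-same v)

⊕-interchange : (u v w x : Vec Bool m) → (u ⊕ v) ⊕ (w ⊕ x) ≡ (u ⊕ w) ⊕ (v ⊕ x)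
⊕-interchange u v w x = begin
  (u ⊕ v) ⊕ (w ⊕ x)  ≡⟨ ⊕-assoc u v (w ⊕ x) ⟩
  u ⊕ (v ⊕ (w ⊕ x))  ≡⟨ cong (u ⊕_) (sym (⊕-assoc v w x)) ⟩
  u ⊕ ((v ⊕ w) ⊕ x)  ≡⟨ cong (λ y → u ⊕ (y ⊕ x)) (⊕-comm v w) ⟩
  u ⊕ ((w ⊕ v) ⊕ x)  ≡⟨ cong (u ⊕_) (⊕-assoc w v x) ⟩
  u ⊕ (w ⊕ (v ⊕ x))  ≡⟨ sym (⊕-assoc u w (v ⊕ x)) ⟩
  (u ⊕ w) ⊕ (v ⊕ x)  ∎
  where open ≡-Reasoning

u⊕v≡0⇒u≡v : (u v : Vec Bool m) → u ⊕ v ≡ zeroV → u ≡ v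
u⊕v≡0⇒u≡v u v u⊕v≡0 = begin
  u            ≡⟨ sym (⊕-identityʳ u) ⟩
  u ⊕ zeroV    ≡⟨ cong (u ⊕_) (sym (⊕-same v)) ⟩
  u ⊕ (v ⊕ v)  ≡⟨ sym (⊕-assoc u v v) ⟩
  (u ⊕ v) ⊕ v  ≡⟨ cong (_⊕ v) u⊕v≡0 ⟩
  zeroV ⊕ v    ≡⟨ ⊕-identityˡ v ⟩
  v            ∎
  where open ≡-Reasoning

head-⊕ : (u v : Vec Bool (suc m)) → head (u ⊕ v) ≡ head u xor head v
head-⊕ (x ∷ u) (y ∷ v) = refl

tail-⊕ : (u v : Vec Bool (suc m)) → tail (u ⊕ v) ≡ tail u ⊕ tail v
tail-⊕ (x ∷ u) (y ∷ v) = refl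

scale-xor : ∀ c c′ (w : Vec Bool m) → scale (c xor c′) w ≡ scale c w ⊕ scale c′ w
scale-xor true  true  w = sym (⊕-same w)
scale-xor true  false w = sym (⊕-identityʳ w)
scale-xor false c′    w = sym (⊕-identityˡ (scale c′ w))

take-replicate : ∀ {A : Set} s {k} {x : A} → take s (replicate (s + k) x) ≡ replicate s x
take-replicate zero    = refl
take-replicate (suc s) = cong (_ ∷_) (take-replicate s)

take-++ : ∀ {A : Set} (xs : Vec A m) (ys : Vec A n) → take m (xs ++ ys) ≡ xs
take-++ []       ys = refl
take-++ (x ∷ xs) ys = cong (x ∷_) (take-++ xs ys)

record Additive (f : Vec Bool m → Vec Bool m′) : Set where
  field
    zero-homo : f zeroV ≡ zeroV
    ⊕-homo    : ∀ u v → f (u ⊕ v) ≡ f u ⊕ f v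

  scale-homo : ∀ c v → f (scale c v) ≡ scale c (f v)
  scale-homo true  v = refl
  scale-homo false v = zero-homo

false∷-additive : Additive {m} (false ∷_)
false∷-additive = record { zero-homo = refl ; ⊕-homo = λ _ _ → refl }

take-additive : ∀ s {k} → Additive (take s {k})
take-additive s = record { zero-homo = take-replicate s ; ⊕-homo = take-zipWith _xor_ }

sumCols-additive : {f : Vec Bool m → Vec Bool m′} → Additive f →
                   (A : Cols n m) (T : Subset n) → sumCols (f ∘ A) T ≡ f (sumCols A T)
sumCols-additive f-additive A []      = sym (Additive.zero-homo f-additive)
sumCols-additive f-additive A (c ∷ T) =
  trans (cong₂ _⊕_ (sym (scale-homo c (A zero))) (sumCols-additive f-additive (A ∘ suc) T))
        (sym (⊕-homo _ _))
  where open Additive f-additive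

sumCols-cong : (A B : Cols n m) (T : Subset n) → (∀ {i} → i ∈ T → A i ≡ B i) → sumCols A T ≡ sumCols B T
sumCols-cong A B []          A≗B = refl
sumCols-cong A B (true ∷ T)  A≗B = cong₂ _⊕_ (A≗B here) (sumCols-cong (A ∘ suc) (B ∘ suc) T (A≗B ∘ there))
sumCols-cong A B (false ∷ T) A≗B = cong (zeroV ⊕_) (sumCols-cong (A ∘ suc) (B ∘ suc) T (A≗B ∘ there))

sumCols-∣0∣ : (A : Cols n m) (T : Subset n) → ∣ T ∣ ≡ 0 → sumCols A T ≡ zeroV
sumCols-∣0∣ A []          _     = refl
sumCols-∣0∣ A (true ∷ T)  ()
sumCols-∣0∣ A (false ∷ T) ∣T∣≡0 = trans (⊕-identityˡ _) (sumCols-∣0∣ (A ∘ suc) T ∣T∣≡0)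

sumCols-⊥ : (A : Cols n m) → sumCols A ⊥ ≡ zeroV
sumCols-⊥ {n} A = sumCols-∣0∣ A ⊥ (∣⊥∣≡0 n)

sumCols-∣1∣ : (A : Cols n m) (T : Subset n) → ∣ T ∣ ≡ 1 → ∃ λ i → sumCols A T ≡ A i
sumCols-∣1∣ A (true ∷ T) ∣T∣≡1 =
  zero , trans (cong (A zero ⊕_) (sumCols-∣0∣ (A ∘ suc) T (ℕ-suc-injective ∣T∣≡1))) (⊕-identityʳ (A zero))
sumCols-∣1∣ A (false ∷ T) ∣T∣≡1 =
  let i , ΣT≡Ai = sumCols-∣1∣ (A ∘ suc) T ∣T∣≡1 in suc i , trans (⊕-identityˡ _) ΣT≡Ai

sumCols-update : (A : Cols n m) (T : Subset n) {j : Fin n} (c : Bool) → j ∉ T →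
                 sumCols A (T [ j ]≔ c) ≡ sumCols A T ⊕ scale c (A j)
sumCols-update A (true ∷ T)  {zero}  c j∉T = contradiction here j∉T
sumCols-update A (false ∷ T) {zero}  c _   =
  trans (⊕-comm _ _) (cong (_⊕ scale c (A zero)) (sym (⊕-identityˡ _)))
sumCols-update A (c′ ∷ T)    {suc j} c j∉T =
  trans (cong (scale c′ (A zero) ⊕_) (sumCols-update (A ∘ suc) T c (j∉T ∘ there))) (sym (⊕-assoc _ _ _))

sumCols-++ : (xs : Vec (Vec Bool m) a) (ys : Vec (Vec Bool m) b) (T₁ : Subset a) (T₂ : Subset b) →
             sumCols (lookup (xs ++ ys)) (T₁ ++ T₂) ≡ sumCols (lookup xs) T₁ ⊕ sumCols (lookup ys) T₂
sumCols-++ []       ys []       T₂ = sym (⊕-identityˡ _)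
sumCols-++ (x ∷ xs) ys (c ∷ T₁) T₂ =
  trans (cong (scale c x ⊕_) (sumCols-++ xs ys T₁ T₂)) (sym (⊕-assoc _ _ _))

sumCols-map : {f : Vec Bool m → Vec Bool m′} → Additive f → (xs : Vec (Vec Bool m) n) (T : Subset n) →
              sumCols (lookup (map f xs)) T ≡ f (sumCols (lookup xs) T)
sumCols-map f-additive xs T =
  trans (sumCols-cong _ _ T (λ {i} _ → lookup-map i _ xs)) (sumCols-additive f-additive (lookup xs) T)

-- Subset n is Vec Bool n, so ∣_∣ is also the Hamming weight of a vector.
∣p⊕q∣≤∣p∣+∣q∣ : (p q : Subset n) → ∣ p ⊕ q ∣ ≤ ∣ p ∣ + ∣ q ∣
∣p⊕q∣≤∣p∣+∣q∣ []          []          = z≤n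
∣p⊕q∣≤∣p∣+∣q∣ (true ∷ p)  (true ∷ q)  =
  ≤-trans (∣p⊕q∣≤∣p∣+∣q∣ p q) (m≤n⇒m≤1+n (+-monoʳ-≤ ∣ p ∣ (n≤1+n ∣ q ∣)))
∣p⊕q∣≤∣p∣+∣q∣ (true ∷ p)  (false ∷ q) = s≤s (∣p⊕q∣≤∣p∣+∣q∣ p q)
∣p⊕q∣≤∣p∣+∣q∣ (false ∷ p) (true ∷ q)  =
  ≤-trans (s≤s (∣p⊕q∣≤∣p∣+∣q∣ p q)) (≤-reflexive (sym (+-suc ∣ p ∣ ∣ q ∣)))
∣p⊕q∣≤∣p∣+∣q∣ (false ∷ p) (false ∷ q) = ∣p⊕q∣≤∣p∣+∣q∣ p q

∣sumCols∣≤∣T∣ : (B : Cols n m) → (∀ i → ∣ B i ∣ ≤ 1) → (T : Subset n) → ∣ sumCols B T ∣ ≤ ∣ T ∣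
∣sumCols∣≤∣T∣ {m = m} B _ []  = ≤-reflexive (∣⊥∣≡0 m)
∣sumCols∣≤∣T∣ B B≤1 (true ∷ T)  =
  ≤-trans (∣p⊕q∣≤∣p∣+∣q∣ (B zero) _) (+-mono-≤ (B≤1 zero) (∣sumCols∣≤∣T∣ (B ∘ suc) (B≤1 ∘ suc) T))
∣sumCols∣≤∣T∣ B B≤1 (false ∷ T) =
  subst (_≤ ∣ T ∣) (cong ∣_∣ (sym (⊕-identityˡ (sumCols (B ∘ suc) T)))) (∣sumCols∣≤∣T∣ (B ∘ suc) (B≤1 ∘ suc) T)

0<∣p∣⇒nonempty : (p : Subset n) → 0 < ∣ p ∣ → Nonempty p
0<∣p∣⇒nonempty (true ∷ p)  _      = zero , here
0<∣p∣⇒nonempty (false ∷ p) 0<∣p∣ = let i , i∈p = 0<∣p∣⇒nonempty p 0<∣p∣ in suc i , there i∈p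

nonempty-++⁻ : (p : Subset a) {q : Subset b} → Nonempty (p ++ q) → Nonempty p ⊎ Nonempty q
nonempty-++⁻ []          q≠∅                = inj₂ q≠∅
nonempty-++⁻ (true ∷ p)  _                  = inj₁ (zero , here)
nonempty-++⁻ (false ∷ p) (suc i , there i∈) with nonempty-++⁻ p (i , i∈)
... | inj₁ (j , j∈p) = inj₁ (suc j , there j∈p)
... | inj₂ q≠∅       = inj₂ q≠∅

++-⊆⁻ : (p₁ q₁ : Subset a) {p₂ q₂ : Subset b} → p₁ ++ p₂ ⊆ q₁ ++ q₂ → p₁ ⊆ q₁ × p₂ ⊆ q₂
++-⊆⁻ []       []       p⊆q = (λ ()) , p⊆q
++-⊆⁻ (x ∷ p₁) (y ∷ q₁) p⊆q = x∷p₁⊆y∷q₁ , proj₂ (++-⊆⁻ p₁ q₁ (drop-∷-⊆ p⊆q))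
  where
  x∷p₁⊆y∷q₁ : x ∷ p₁ ⊆ y ∷ q₁
  x∷p₁⊆y∷q₁ here with p⊆q here
  ... | here = here
  x∷p₁⊆y∷q₁ (there i∈p₁) = there (proj₁ (++-⊆⁻ p₁ q₁ (drop-∷-⊆ p⊆q)) i∈p₁)

∣p++q∣≡∣p∣+∣q∣ : (p : Subset a) (q : Subset b) → ∣ p ++ q ∣ ≡ ∣ p ∣ + ∣ q ∣
∣p++q∣≡∣p∣+∣q∣ []          q = refl
∣p++q∣≡∣p∣+∣q∣ (true ∷ p)  q = cong suc (∣p++q∣≡∣p∣+∣q∣ p q)
∣p++q∣≡∣p∣+∣q∣ (false ∷ p) q = ∣p++q∣≡∣p∣+∣q∣ p q

x∉p-x : (p : Subset n) (x : Fin n) → x ∉ p - x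
x∉p-x (_ ∷ p) zero    ()
x∉p-x (_ ∷ p) (suc x) (there x∈p-x) = x∉p-x p x x∈p-x

∣p∣≡1+∣p-x∣ : (p : Subset n) {x : Fin n} → x ∈ p → ∣ p ∣ ≡ suc ∣ p - x ∣
∣p∣≡1+∣p-x∣ (true ∷ p)  here        = cong suc (cong ∣_∣ (sym (p─⊥≡p p)))
∣p∣≡1+∣p-x∣ (true ∷ p)  (there x∈p) = cong suc (∣p∣≡1+∣p-x∣ p x∈p)
∣p∣≡1+∣p-x∣ (false ∷ p) (there x∈p) = ∣p∣≡1+∣p-x∣ p x∈p

∈-update⁻ : (p : Subset n) {x y : Fin n} {c : Bool} → x ∈ p [ y ]≔ c → x ≢ y → x ∈ p
∈-update⁻ p {x} {c = c} x∈p′ x≢y = lookup⇒[]= x p (trans (sym (lookup∘update′ x≢y p c)) ([]=⇒lookup x∈p′))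

circuit-sum : {A : Cols n m} {C : Subset n} → Circuit A C → sumCols A C ≡ zeroV
circuit-sum {C = C} ((T , T⊆C , T≠∅ , ΣT≡0) , minimal) with ≡-dec _≟_ T C
... | yes refl = ΣT≡0
... | no  T≢C  = ⊥-elim (minimal T T⊆C T≢C (T , id , T≠∅ , ΣT≡0))

sumCols-∣2∣≢0 : (A : Cols n m) → Injective _≡_ _≡_ A → (T : Subset n) → ∣ T ∣ ≡ 2 → sumCols A T ≢ zeroV
sumCols-∣2∣≢0 A inj (true ∷ T) ∣T∣+1≡2 Σ≡0 with sumCols-∣1∣ (A ∘ suc) T (ℕ-suc-injective ∣T∣+1≡2)
... | i , ΣT≡Ai with inj (trans (u⊕v≡0⇒u≡v _ _ Σ≡0) ΣT≡Ai)
...   | ()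
sumCols-∣2∣≢0 A inj (false ∷ T) ∣T∣≡2 Σ≡0 =
  sumCols-∣2∣≢0 (A ∘ suc) (λ eq → Fin.suc-injective (inj eq)) T ∣T∣≡2 (trans (sym (⊕-identityˡ _)) Σ≡0)

nonzero-injective⇒simple : (A : Cols n m) → (∀ i → A i ≢ zeroV) → Injective _≡_ _≡_ A → Simple A
nonzero-injective⇒simple A nonzero inj =
    (λ (C , circuit , ∣C∣≡1) → let i , ΣC≡Ai = sumCols-∣1∣ A C ∣C∣≡1 in
                                nonzero i (trans (sym ΣC≡Ai) (circuit-sum circuit)))
  , (λ (C , circuit , ∣C∣≡2) → sumCols-∣2∣≢0 A inj C ∣C∣≡2 (circuit-sum circuit))

eliminate : Vec Bool (suc m) → Vec Bool (suc m) → Vec Bool m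
eliminate w v = tail (v ⊕ scale (head v) w)

eliminate-additive : (w : Vec Bool (suc m)) → Additive (eliminate w)
eliminate-additive w = record { zero-homo = cong tail (⊕-same zeroV) ; ⊕-homo = homo }
  where
  open ≡-Reasoning
  homo : ∀ u v → eliminate w (u ⊕ v) ≡ eliminate w u ⊕ eliminate w v
  homo u v = begin
    tail ((u ⊕ v) ⊕ scale (head (u ⊕ v)) w)
      ≡⟨ cong (λ c → tail ((u ⊕ v) ⊕ scale c w)) (head-⊕ u v) ⟩
    tail ((u ⊕ v) ⊕ scale (head u xor head v) w)
      ≡⟨ cong (λ y → tail ((u ⊕ v) ⊕ y)) (scale-xor (head u) (head v) w) ⟩
    tail ((u ⊕ v) ⊕ (scale (head u) w ⊕ scale (head v) w))
      ≡⟨ cong tail (⊕-interchange u v _ _) ⟩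
    tail ((u ⊕ scale (head u) w) ⊕ (v ⊕ scale (head v) w))
      ≡⟨ tail-⊕ (u ⊕ scale (head u) w) (v ⊕ scale (head v) w) ⟩
    eliminate w u ⊕ eliminate w v
      ∎

eliminate≡0 : {w : Vec Bool (suc m)} → head w ≡ true → (v : Vec Bool (suc m)) →
              eliminate w v ≡ zeroV → v ≡ scale (head v) w
eliminate≡0 {w = true ∷ w} refl (true ∷ v)  eq = cong (true ∷_) (u⊕v≡0⇒u≡v v w eq)
eliminate≡0 {w = true ∷ w} refl (false ∷ v) eq = cong (false ∷_) (u⊕v≡0⇒u≡v v zeroV eq)

-- The dependency T of the reduced columns lifts to T, with the pivot j added exactly when the
-- first coordinate of the sum over T is 1.
dependent-lift-pivot : (A : Cols n (suc m)) {S : Subset n} {j : Fin n} → j ∈ S → head (A j) ≡ true →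
                       Dependent (eliminate (A j) ∘ A) (S - j) → Dependent A S
dependent-lift-pivot A {S} {j} j∈S pivot (T , T⊆S-j , (i , i∈T) , ΣT≡0) =
  T [ j ]≔ c , T′⊆S , (i , []≔-minimal T i j i≢j i∈T) , (begin
    sumCols A (T [ j ]≔ c)         ≡⟨ sumCols-update A T c j∉T ⟩
    sumCols A T ⊕ scale c (A j)    ≡⟨ cong (_⊕ scale c (A j)) (eliminate≡0 pivot (sumCols A T) ΣT≡0′) ⟩
    scale c (A j) ⊕ scale c (A j)  ≡⟨ ⊕-same _ ⟩
    zeroV                          ∎)
  where
  open ≡-Reasoning
  c = head (sumCols A T)
  ΣT≡0′ : eliminate (A j) (sumCols A T) ≡ zeroV
  ΣT≡0′ = trans (sym (sumCols-additive (eliminate-additive (A j)) A T)) ΣT≡0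
  j∉T : j ∉ T
  j∉T j∈T = x∉p-x S j (T⊆S-j j∈T)
  i≢j : i ≢ j
  i≢j refl = j∉T i∈T
  T′⊆S : T [ j ]≔ c ⊆ S
  T′⊆S {x} x∈T′ with x Fin.≟ j
  ... | yes refl = j∈S
  ... | no  x≢j  = p─q⊆p S ⁅ j ⁆ (T⊆S-j (∈-update⁻ T x∈T′ x≢j))

dependent-lift-tail : (A : Cols n (suc m)) {S : Subset n} → (∀ {i} → i ∈ S → head (A i) ≡ false) →
                      Dependent (tail ∘ A) S → Dependent A S
dependent-lift-tail A heads≡false (T , T⊆S , T≠∅ , ΣT≡0) = T , T⊆S , T≠∅ , (begin
  sumCols A T                        ≡⟨ sumCols-cong A ((false ∷_) ∘ tail ∘ A) T (≡false∷tail ∘ heads≡false ∘ T⊆S) ⟩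
  sumCols ((false ∷_) ∘ tail ∘ A) T  ≡⟨ sumCols-additive false∷-additive (tail ∘ A) T ⟩
  false ∷ sumCols (tail ∘ A) T       ≡⟨ cong (false ∷_) ΣT≡0 ⟩
  zeroV                              ∎)
  where
  open ≡-Reasoning
  ≡false∷tail : {v : Vec Bool (suc m)} → head v ≡ false → v ≡ false ∷ tail v
  ≡false∷tail {v = _ ∷ _} refl = refl

dependent-if-large : ∀ m (A : Cols n m) (S : Subset n) → m < ∣ S ∣ → Dependent A S
dependent-if-large zero A S 0<∣S∣ with sumCols A S in ΣS≡[]
... | [] = S , id , 0<∣p∣⇒nonempty S 0<∣S∣ , ΣS≡[]
dependent-if-large (suc m) A S m+1<∣S∣ with Fin.any? (λ j → j ∈? S ×-dec head (A j) ≟ true)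
... | yes (j , j∈S , pivot) =
  dependent-lift-pivot A j∈S pivot
    (dependent-if-large m _ (S - j) (≤-pred (subst (suc m <_) (∣p∣≡1+∣p-x∣ S j∈S) m+1<∣S∣)))
... | no  no-pivot =
  dependent-lift-tail A (λ i∈S → ¬-not (λ pivot → no-pivot (-, i∈S , pivot)))
    (dependent-if-large m (tail ∘ A) S (<⇒≤ m+1<∣S∣))

HasIndependentSet : Cols n m → ℕ → Set
HasIndependentSet A d = ∃ λ S → Independent A S × ∣ S ∣ ≡ d

full-rank : (A : Cols n m) → HasIndependentSet A m → HasRank A m
full-rank A basis = basis , λ S independent → ≮⇒≥ (independent ∘ dependent-if-large _ A S)

independent-outside∷ : (A : Cols (suc n) m) {S : Subset n} →
                       Independent (A ∘ suc) S → Independent A (false ∷ S)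
independent-outside∷ A independent (true ∷ T , T⊆S′ , _) with T⊆S′ here
... | ()
independent-outside∷ A independent (false ∷ T , T⊆S′ , (suc i , there i∈T) , ΣT≡0) =
  independent (T , drop-∷-⊆ T⊆S′ , (i , i∈T) , trans (sym (⊕-identityˡ _)) ΣT≡0)

infixr 5 _⋈_
_⋈_ : Vec (Vec Bool m) a → Vec (Vec Bool m) b → Vec (Vec Bool (suc m)) (a + b)
xs ⋈ ys = map (false ∷_) xs ++ map (true ∷_) ys

sumCols-⋈ : (xs : Vec (Vec Bool m) a) (y : Vec Bool m) (ys : Vec (Vec Bool m) b) (T : Subset a) (c : Bool) →
            sumCols (lookup (xs ⋈ y ∷ ys)) (T ++ c ∷ ⊥) ≡ c ∷ (sumCols (lookup xs) T ⊕ scale c y)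
sumCols-⋈ xs y ys T c = begin
  sumCols (lookup (xs ⋈ y ∷ ys)) (T ++ c ∷ ⊥)
    ≡⟨ sumCols-++ (map (false ∷_) xs) (map (true ∷_) (y ∷ ys)) T (c ∷ ⊥) ⟩
  sumCols (lookup (map (false ∷_) xs)) T ⊕ (scale c (true ∷ y) ⊕ sumCols (lookup (map (true ∷_) ys)) ⊥)
    ≡⟨ cong₂ _⊕_ (sumCols-map false∷-additive xs T)
                 (trans (cong (scale c (true ∷ y) ⊕_) (sumCols-⊥ (lookup (map (true ∷_) ys)))) (⊕-identityʳ _)) ⟩
  (false ∷ sumCols (lookup xs) T) ⊕ scale c (true ∷ y)
    ≡⟨ cong ((false ∷ sumCols (lookup xs) T) ⊕_) (scale-∷ c) ⟩
  c ∷ (sumCols (lookup xs) T ⊕ scale c y)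
    ∎
  where
  open ≡-Reasoning
  scale-∷ : ∀ c → scale c (true ∷ y) ≡ c ∷ scale c y
  scale-∷ true  = refl
  scale-∷ false = refl

⋈-independent : (xs : Vec (Vec Bool m) a) (ys : Vec (Vec Bool m) (suc b)) {S : Subset a} →
                Independent (lookup xs) S → Independent (lookup (xs ⋈ ys)) (S ++ ⁅ zero ⁆)
⋈-independent {a = a} xs (y ∷ ys) {S} independent (T , T⊆S′ , T≠∅ , ΣT≡0) with splitAt a T
... | T₁ , c ∷ T₂ , refl with ++-⊆⁻ T₁ S T⊆S′
... | T₁⊆S , cT₂⊆⁅0⁆ with Empty-unique (λ (i , i∈T₂) → ∉⊥ (drop-∷-⊆ cT₂⊆⁅0⁆ i∈T₂))
-- the first coordinate of the sum over T is c, which forces c = false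
... | refl with ∷-injective (trans (sym (sumCols-⋈ xs y ys T₁ c)) ΣT≡0)
... | refl , ΣT₁⊕0≡0 with nonempty-++⁻ T₁ T≠∅
... | inj₁ T₁≠∅      = independent (T₁ , T₁⊆S , T₁≠∅ , u⊕v≡0⇒u≡v _ _ ΣT₁⊕0≡0)
... | inj₂ (_ , i∈⊥) = ∉⊥ i∈⊥

⋈-basis : (xs : Vec (Vec Bool m) a) (ys : Vec (Vec Bool m) (suc b)) →
          HasIndependentSet (lookup xs) d → HasIndependentSet (lookup (xs ⋈ ys)) (suc d)
⋈-basis {b = b} {d = d} xs ys (S , independent , ∣S∣≡d) =
  S ++ ⁅ zero ⁆ , ⋈-independent xs ys independent ,
  trans (∣p++q∣≡∣p∣+∣q∣ S ⁅ zero ⁆) (trans (cong₂ _+_ ∣S∣≡d (∣⁅x⁆∣≡1 {n = suc b} zero)) (+-comm d 1))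

⋈-nonzero : {xs : Vec (Vec Bool m) a} (ys : Vec (Vec Bool m) b) →
            All (_≢ zeroV) xs → All (_≢ zeroV) (xs ⋈ ys)
⋈-nonzero ys xs≢0 =
  All.++⁺ (All.map⁺ (All.map (λ x≢0 → x≢0 ∘ ∷-injectiveʳ) xs≢0)) (All.map⁺ (All.universal (λ _ ()) ys))

⋈-unique : {xs : Vec (Vec Bool m) a} {ys : Vec (Vec Bool m) b} → Unique xs → Unique ys → Unique (xs ⋈ ys)
⋈-unique {xs = xs} {ys} xs! ys! =
  AllPairs.++⁺ (Unique.map⁺ ∷-injectiveʳ xs!) (Unique.map⁺ ∷-injectiveʳ ys!)
    (All.map⁺ (All.universal (λ _ → All.map⁺ (All.universal (λ _ ()) ys)) xs))

mersenne : ℕ → ℕ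
mersenne zero    = zero
mersenne (suc k) = mersenne k + suc (mersenne k)

suc-mersenne : ∀ k → suc (mersenne k) ≡ 2 ^ k
suc-mersenne zero    = refl
suc-mersenne (suc k) =
  trans (cong₂ _+_ (suc-mersenne k) (suc-mersenne k)) (cong (2 ^ k +_) (sym (+-identityʳ (2 ^ k))))

nonzeros : ∀ k → Vec (Vec Bool k) (mersenne k)
cube     : ∀ k → Vec (Vec Bool k) (suc (mersenne k))

nonzeros zero    = []
nonzeros (suc k) = nonzeros k ⋈ cube k

cube k = zeroV ∷ nonzeros k

nonzeros-nonzero : ∀ k → All (_≢ zeroV) (nonzeros k)
nonzeros-nonzero zero    = []
nonzeros-nonzero (suc k) = ⋈-nonzero (cube k) (nonzeros-nonzero k)

nonzeros-unique : ∀ k → Unique (nonzeros k)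
cube-unique     : ∀ k → Unique (cube k)

nonzeros-unique zero    = []
nonzeros-unique (suc k) = ⋈-unique (nonzeros-unique k) (cube-unique k)

cube-unique k = All.map ≢-sym (nonzeros-nonzero k) ∷ nonzeros-unique k

nonzeros-basis : ∀ k → HasIndependentSet (lookup (nonzeros k)) k
nonzeros-basis zero    = [] , (λ { (_ , _ , (() , _) , _) }) , refl
nonzeros-basis (suc k) = ⋈-basis (nonzeros k) (cube k) (nonzeros-basis k)

lightCount : ℕ → ℕ → ℕ
lightCount zero    k = mersenne k
lightCount (suc s) k = lightCount s k + suc (mersenne k)

light : ∀ s k → Vec (Vec Bool (s + k)) (lightCount s k)
light zero    k = nonzeros k
light (suc s) k = light s k ⋈ map (⊥ ++_) (cube k)

heavy : ∀ s k → Vec Bool (s + k)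
heavy s k = ⊤ {s} ++ ⊥ {k}

columns : ∀ s k → Vec (Vec Bool (s + k)) (suc (lightCount s k))
columns s k = heavy s k ∷ light s k

columns-length : ∀ s k → suc (lightCount s k) ≡ 2 ^ k * (s + 1)
columns-length zero    k = trans (suc-mersenne k) (sym (*-identityʳ (2 ^ k)))
columns-length (suc s) k = begin
  suc (lightCount s k) + suc (mersenne k)  ≡⟨ cong₂ _+_ (columns-length s k) (suc-mersenne k) ⟩
  2 ^ k * (s + 1) + 2 ^ k                  ≡⟨ +-comm (2 ^ k * (s + 1)) (2 ^ k) ⟩
  2 ^ k + 2 ^ k * (s + 1)                  ≡⟨ *-suc (2 ^ k) (s + 1) ⟨
  2 ^ k * (suc s + 1)                      ∎
  where open ≡-Reasoning

light-nonzero : ∀ s k → All (_≢ zeroV) (light s k)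
light-nonzero zero    k = nonzeros-nonzero k
light-nonzero (suc s) k = ⋈-nonzero _ (light-nonzero s k)

light-unique : ∀ s k → Unique (light s k)
light-unique zero    k = nonzeros-unique k
light-unique (suc s) k = ⋈-unique (light-unique s k) (Unique.map⁺ (++-injectiveʳ ⊥ ⊥) (cube-unique k))

light-basis : ∀ s k → HasIndependentSet (lookup (light s k)) (s + k)
light-basis zero    k = nonzeros-basis k
light-basis (suc s) k = ⋈-basis (light s k) (map (⊥ ++_) (cube k)) (light-basis s k)

prefixWeight : ∀ s {k} → Vec Bool (s + k) → ℕ
prefixWeight s v = ∣ take s v ∣

heavy-prefixWeight : ∀ s k → prefixWeight s (heavy s k) ≡ s
heavy-prefixWeight s k = trans (cong ∣_∣ (take-++ (⊤ {s}) (⊥ {k}))) (∣⊤∣≡n s)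

light-prefixWeight : ∀ s k → All (λ v → prefixWeight s v ≤ 1) (light s k)
light-prefixWeight zero    k = All.universal (λ _ → z≤n) _
light-prefixWeight (suc s) k =
  All.++⁺ (All.map⁺ (light-prefixWeight s k))
          (All.map⁺ (All.map⁺ (All.universal (λ v → s≤s (≤-reflexive (prefixWeight-⊥++ v))) (cube k))))
  where
  prefixWeight-⊥++ : (v : Vec Bool k) → prefixWeight s (⊥ ++ v) ≡ 0
  prefixWeight-⊥++ v = trans (cong ∣_∣ (take-++ (⊥ {s}) v)) (∣⊥∣≡0 s)

heavy∉light : ∀ {s} k → 2 ≤ s → All (heavy s k ≢_) (light s k)
heavy∉light {s} k 2≤s =
  All.map (λ v≤1 heavy≡v → <⇒≱ 2≤s (≤-trans (weight≡ heavy≡v) v≤1)) (light-prefixWeight s k)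
  where
  weight≡ : ∀ {v} → heavy s k ≡ v → s ≤ prefixWeight s v
  weight≡ heavy≡v = ≤-reflexive (trans (sym (heavy-prefixWeight s k)) (cong (prefixWeight s) heavy≡v))

columns-simple : ∀ {s} k → 2 ≤ s → Simple (lookup (columns s k))
columns-simple {suc s} k 2≤s =
  nonzero-injective⇒simple _ (All.lookup⁺ ((λ ()) ∷ light-nonzero (suc s) k))
    (λ {i} {j} → Unique.lookup-injective (heavy∉light k 2≤s ∷ light-unique (suc s) k) i j)

columns-rank : ∀ s k → HasRank (lookup (columns s k)) (s + k)
columns-rank s k =
  let S , independent , ∣S∣≡s+k = light-basis s k in
  full-rank _ (false ∷ S , independent-outside∷ _ independent , ∣S∣≡s+k)

heavy-loose : ∀ s k → Loose (lookup (columns s k)) (s + k) k zero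
heavy-loose s k (false ∷ C) _       ()
heavy-loose s k (true ∷ C)  circuit here = s≤s (begin
  s + k ∸ k                                           ≡⟨ m+n∸n≡m s k ⟩
  s                                                   ≡⟨ sym (heavy-prefixWeight s k) ⟩
  prefixWeight s (heavy s k)                          ≡⟨ cong (prefixWeight s) heavy≡ΣC ⟩
  ∣ take s (sumCols (lookup (light s k)) C) ∣         ≡⟨ cong ∣_∣ (sumCols-additive (take-additive s) _ C) ⟨
  ∣ sumCols (take s ∘ lookup (light s k)) C ∣         ≤⟨ ∣sumCols∣≤∣T∣ _ (All.lookup⁺ (light-prefixWeight s k)) C ⟩
  ∣ C ∣                                               ∎)
  where
  open ≤-Reasoning
  heavy≡ΣC : heavy s k ≡ sumCols (lookup (light s k)) C
  heavy≡ΣC = u⊕v≡0⇒u≡v _ _ (circuit-sum circuit)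

LooseExample : (k n r : ℕ) → Set
LooseExample k n r = Σ ℕ λ m → Σ (Cols n m) λ A → Simple A × HasRank A r × ∃ λ e → Loose A r k e

proposition2p1 : (r k : ℕ) → 2 ≤ r → k ≤ r ∸ 2 →
    Σ ℕ λ m → Σ (Cols (2 ^ k * (r ∸ k + 1)) m) λ A →
      Simple A × HasRank A r × ∃ λ e → Loose A r k e
proposition2p1 r k 2≤r k≤r∸2 =
  subst₂ (LooseExample k) (columns-length s k) (m∸n+n≡m k≤r)
    (s + k , lookup (columns s k) , columns-simple k 2≤s , columns-rank s k , zero , heavy-loose s k)
  where
  s = r ∸ k
  k≤r : k ≤ r
  k≤r = ≤-trans k≤r∸2 (m∸n≤m r 2)
  2≤s : 2 ≤ s
  2≤s = ≤-trans (≤-reflexive (sym (m∸[m∸n]≡n 2≤r))) (∸-monoʳ-≤ r k≤r∸2)
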